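{- Let $a>b\ge 1$ and $k\ge 1$ be integers, let $M=\{la : 1\le l\le k\}\cup\{la+b : 0\le l\le k\}$, and let $A\subset\mathbb Z$ be $M$-avoiding with $0\in A$. For $0\le i<k$ let $T_i=A\cap[ia+b+1,(i+1)a-1]$ and let $T=\bigcup_{i=0}^{k-1}T_i$. To each $\alpha\in T$ associate a set $\{v_\alpha,w_\alpha\}$ as follows (see context). Then: (1) For each $0\le i<k$ and each $\alpha\in T_i$, there exists at most one $\beta\in T$ such that $\alpha>\beta$ and $\{v_\alpha,w_\alpha\}\cap\{v_\beta,w_\beta\}\neq\varnothing$; moreover, for such $\beta$ this intersection has exactly one element and $\beta\notin T_i$. (2) For each $0\le i'<k$ and each $\beta\in T_{i'}$, there exists at most one $\alpha\in T$ such that $\alpha>\beta$ and $\{v_\alpha,w_\alpha\}\cap\{v_\beta,w_\beta\}\neq\varnothing$; moreover, for such $\alpha$ this intersection has exactly one element and $\alpha\notin T_{i'}$.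
   Context: A set $A\subset\mathbb Z$ is called $M$-avoiding if there are no $x,y\in A$ with $x-y\in M$. The interval notation $[u,v]$ denotes the set of integers $z$ with $u\le z\le v$. For $x\in\mathbb Z$ let $S_x=\{x,\,x+a,\dots,x+ka,\,x+ka+b\}$, and let $I=\{x\in\{0,\dots,b-1\} : S_x\cap A=\varnothing\}$. Construction of $v_\alpha,w_\alpha$: for $\alpha\in T_i$ ($0\le i<k$), write uniquely $\alpha=ia+jb+\widehat\alpha_0$ with integers $j\ge1$ and $0\le\widehat\alpha_0<b$. Set $v_\alpha=\alpha+(k-i)a+b$. If $j\ge2$, set $w_\alpha=\alpha+(k-i)a$. If $j=1$, put $\widehat\alpha_n=\widehat\alpha_0+n(a-b)$ for $n\ge0$, let $N$ be the minimum $n\ge0$ such that $\widehat\alpha_n\in I$ or $\widehat\alpha_n\ge 2b-a$, and set $w_\alpha=\widehat\alpha_N$ if $\widehat\alpha_N\in I$ and $w_\alpha=\widehat\alpha_N+(k+1)a$ otherwise. The definitions of $M$ and $I$ are reconstructed from how they are used in the paper's section (the paper's earlier definitions are not included in the excerpt). -}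

module Defs where

open import Data.Nat as ℕ using (ℕ; zero; suc; NonZero)
open import Data.Integer using (ℤ; +_; _+_; _-_; _*_; _≤_; _<_; _≤?_; _<?_; _/ℕ_; _%ℕ_)
open import Data.Bool using (Bool; true; false; if_then_else_; not; _∧_)
open import Data.List using (List; map; upTo; _++_; [_])
open import Data.Bool.ListAction using (all)
open import Data.Product using (Σ; ∃; _×_; _,_)
open import Data.Sum using (_⊎_)
open import Relation.Nullary using (¬_)
open import Relation.Nullary.Decidable using (⌊_⌋)
open import Relation.Binary.PropositionalEquality using (_≡_)

-- Throughout: a, b, k are natural numbers (the paper's integers a > b ≥ 1, k ≥ 1),
-- and a subset A ⊆ ℤ is given by its (Boolean) characteristic function.

_∈A_ : ℤ → (ℤ → Bool) → Set
x ∈A A = A x ≡ true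

InM : (a b k : ℕ) → ℤ → Set
InM a b k d =
  (Σ ℕ λ l → (1 ℕ.≤ l) × (l ℕ.≤ k) × (d ≡ + l * + a))
  ⊎ (Σ ℕ λ l → (l ℕ.≤ k) × (d ≡ + l * + a + + b))

MAvoiding : (a b k : ℕ) → (ℤ → Bool) → Set
MAvoiding a b k A = ∀ x y → x ∈A A → y ∈A A → ¬ InM a b k (x - y)

InT : (a b k : ℕ) → (ℤ → Bool) → ℕ → ℤ → Set
InT a b k A i α =
  α ∈A A × (+ i * + a + + b + + 1 ≤ α) × (α ≤ + (suc i) * + a - + 1)

InTunion : (a b k : ℕ) → (ℤ → Bool) → ℤ → Set
InTunion a b k A α = Σ ℕ λ i → (i ℕ.< k) × InT a b k A i α

S : (a b k : ℕ) → ℤ → List ℤ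
S a b k x = map (λ l → x + + l * + a) (upTo (suc k)) ++ [ x + + k * + a + + b ]

inI : (a b k : ℕ) → (ℤ → Bool) → ℤ → Bool
inI a b k A x = ⌊ + 0 ≤? x ⌋ ∧ ⌊ x <? + b ⌋ ∧ all (λ y → not (A y)) (S a b k x)

-- The fuel argument
-- bounds the number of steps; since α̂_0 ≥ 0 and a - b ≥ 1 we have α̂_n ≥ n,
-- so the stopping condition holds for some n ≤ 2b, and fuel 2b+1 always suffices
-- (the fuel-exhausted branch is never reached).
wSearch : (a b k : ℕ) → (ℤ → Bool) → ℕ → ℤ → ℤ
wSearch a b k A zero x = x
wSearch a b k A (suc f) x =
  if inI a b k A x then x
  else (if ⌊ + 2 * + b - + a ≤? x ⌋ then x + + (suc k) * + a
        else wSearch a b k A f (x + (+ a - + b)))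

-- For α ∈ T_i:  α = i a + j b + α̂_0 with j ≥ 1, 0 ≤ α̂_0 < b,
-- i.e. j = (α - i a) div b and α̂_0 = (α - i a) mod b.
jOf : (a b : ℕ) .{{_ : NonZero b}} → ℕ → ℤ → ℤ
jOf a b i α = (α - + i * + a) /ℕ b

hat0 : (a b : ℕ) .{{_ : NonZero b}} → ℕ → ℤ → ℤ
hat0 a b i α = + ((α - + i * + a) %ℕ b)

vOf : (a b k : ℕ) → ℕ → ℤ → ℤ
vOf a b k i α = α + (+ k - + i) * + a + + b

wOf : (a b k : ℕ) .{{_ : NonZero b}} → (ℤ → Bool) → ℕ → ℤ → ℤ
wOf a b k A i α =
  if ⌊ + 2 ≤? jOf a b i α ⌋
  then α + (+ k - + i) * + a
  else wSearch a b k A (suc (2 ℕ.* b)) (hat0 a b i α)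

InVW : (a b k : ℕ) .{{_ : NonZero b}} → (ℤ → Bool) → ℕ → ℤ → ℤ → Set
InVW a b k A i α z = (z ≡ vOf a b k i α) ⊎ (z ≡ wOf a b k A i α)

InCap : (a b k : ℕ) .{{_ : NonZero b}} → (ℤ → Bool) → ℕ → ℤ → ℕ → ℤ → ℤ → Set
InCap a b k A i α i' β z = InVW a b k A i α z × InVW a b k A i' β z

Meets : (a b k : ℕ) .{{_ : NonZero b}} → (ℤ → Bool) → ℕ → ℤ → ℕ → ℤ → Set
Meets a b k A i α i' β = ∃ λ z → InCap a b k A i α i' β z

MeetsExactlyOnce : (a b k : ℕ) .{{_ : NonZero b}} → (ℤ → Bool) → ℕ → ℤ → ℕ → ℤ → Set
MeetsExactlyOnce a b k A i α i' β =
  ∃ λ z → InCap a b k A i α i' β z × (∀ z' → InCap a b k A i α i' β z' → z' ≡ z)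

{-# OPTIONS --safe #-}
module Submission where

open import Defs
open import Data.Nat as ℕ
open import Data.Nat.Properties
open import Data.Nat.DivMod using (m≡m%n+[m/n]*n; m%n<n)
open import Data.Nat.Tactic.RingSolver using (solve)
open import Data.Integer as ℤ using (ℤ; +_; +≤+; +<+)
import Data.Integer.Properties as ℤₚ
import Data.Integer.Tactic.RingSolver as ℤ-Ring
open import Data.Bool using (Bool; true; false; T; not; _∧_; if_then_else_)
open import Data.Bool.Properties using (¬-not; T-not-≡)
open import Data.List using ([]; _∷_; map; upTo)
open import Data.Bool.ListAction using (all)
open import Data.List.Relation.Unary.Any as Any using (Any; here)
import Data.List.Relation.Unary.Any.Properties as Any
open import Data.List.Relation.Unary.All.Properties using (all⁻; ¬All⇒Any¬)
open import Data.List.Membership.Propositional using (find)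
open import Data.List.Membership.Propositional.Properties using (∈-upTo⁻)
open import Data.Product using (∃-syntax; ∃₂; _×_; _,_; proj₁; proj₂)
open import Data.Sum using (_⊎_; inj₁; inj₂)
open import Data.Empty using (⊥; ⊥-elim)
open import Function using (_∘_; Equivalence)
open import Relation.Nullary using (¬_; yes; no; contradiction)
open import Relation.Nullary.Decidable using (⌊_⌋; isYes≗does; dec-true; T?)
open import Relation.Binary.PropositionalEquality
open import Relation.Binary.Definitions using (tri<; tri≈; tri>)

-- Write α ∈ T_i as α = i a + r with b < r < a, and put d = a − b.  Then v_α = k a + r + b,
-- while w_α is k a + r when r ≥ 2b, and otherwise, with α̂_n = r − b + n d, either α̂_N or
-- (k + 1) a + α̂_N, where α̂_N < b.  Since A is M-avoiding, r determines i, so α ↦ v_α and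
-- α ↦ w_α are injective on T, and the three shapes of w_α lie in disjoint ranges.
--
-- The core is that w_α ≠ v_β for β < α, and v_α ≠ w_β for β < α in the same T_i.  Each
-- equation either contradicts β < α, or puts two points of A at distance l a + b (l ≤ k),
-- or says that for the point i a + b + α̂_0 ∈ A whose w was searched, the tests
-- S_{α̂_0}, …, S_{α̂_N} all met A although j a + α̂_{N+1} ∈ A for some j ≤ i.  An induction
-- along these failed tests keeps a point L a + α̂_m ∈ A with i < L ≤ k; at m = N it differs
-- from j a + α̂_{N+1} by (L − j − 1) a + b ∈ M.  So for β < α the sets {v_α, w_α} and
-- {v_β, w_β} can only meet in v_α = w_β, and both parts follow.

*+-lex-< : ∀ {c i j r s} → i < j → r < c → i * c + r < j * c + s
*+-lex-< {c} {i} {j} {r} {s} i<j r<c = begin-strict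
  i * c + r  <⟨ +-monoʳ-< (i * c) r<c ⟩
  i * c + c  ≡⟨ +-comm (i * c) c ⟩
  suc i * c  ≤⟨ *-monoˡ-≤ c i<j ⟩
  j * c      ≤⟨ m≤m+n (j * c) s ⟩
  j * c + s  ∎
  where open ≤-Reasoning

*+-lex-injective : ∀ {c i j r s} → i * c + r ≡ j * c + s → r < c → s < c → i ≡ j × r ≡ s
*+-lex-injective {c} {i} {j} eq r<c s<c with <-cmp i j
... | tri< i<j _ _ = contradiction eq (<⇒≢ (*+-lex-< i<j r<c))
... | tri> _ _ j<i = contradiction (sym eq) (<⇒≢ (*+-lex-< j<i s<c))
... | tri≈ _ refl _ = refl , +-cancelˡ-≡ (i * c) _ _ eq

+[m+n]-+m≡+n : ∀ m n → + (m + n) ℤ.- + m ≡ + n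
+[m+n]-+m≡+n m n = begin
  + (m + n) ℤ.- + m  ≡⟨ ℤₚ.[+m]-[+n]≡m⊖n (m + n) m ⟩
  (m + n) ℤ.⊖ m      ≡⟨ ℤₚ.⊖-≥ (m≤m+n m n) ⟩
  + (m + n ∸ m)      ≡⟨ cong +_ (m+n∸m≡n m n) ⟩
  + n                ∎
  where open ≡-Reasoning

pos-*+ : ∀ m n o → + (m * n + o) ≡ + m ℤ.* + n ℤ.+ + o
pos-*+ m n o = trans (ℤₚ.pos-+ (m * n) o) (cong (ℤ._+ + o) (ℤₚ.pos-* m n))

all-not≡false⇒Any : ∀ {X : Set} (p : X → Bool) xs → all (not ∘ p) xs ≡ false →
                    Any (λ x → p x ≡ true) xs
all-not≡false⇒Any p xs all≡false =
  Any.map (λ ¬T → ¬-not (¬T ∘ Equivalence.from T-not-≡))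
          (¬All⇒Any¬ (T? ∘ not ∘ p) xs (λ allT → subst T all≡false (all⁻ (not ∘ p) allT)))

≤[+n-1]⇒< : ∀ {m} n → + m ℤ.≤ + n ℤ.- + 1 → m < n
≤[+n-1]⇒< zero    ()
≤[+n-1]⇒< (suc n) (+≤+ m≤n) = s≤s m≤n

nonneg-view : ∀ {m α} → + m ℤ.≤ α → ∃[ n ] α ≡ + n × m ≤ n
nonneg-view (+≤+ m≤n) = _ , refl , m≤n

module Points (a b k : ℕ) (A : ℤ → Bool) where

  A⁺ : ℕ → Set
  A⁺ n = (+ n) ∈A A

  S-test-fails : ∀ {x} → x < b → inI a b k A (+ x) ≡ false →
                 all (not ∘ A) (S a b k (+ x)) ≡ false
  S-test-fails {x} x<b x∉I =
    subst (λ t → t ∧ all (not ∘ A) (S a b k (+ x)) ≡ false) x<b-passes x∉I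
    where
      x<b-passes : ⌊ + x ℤ.<? + b ⌋ ≡ true
      x<b-passes = trans (isYes≗does (+ x ℤ.<? + b)) (dec-true (+ x ℤ.<? + b) (+<+ x<b))

  S-column≡ : ∀ x l → + x ℤ.+ + l ℤ.* + a ≡ + (l * a + x)
  S-column≡ x l = trans (ℤₚ.+-comm (+ x) (+ l ℤ.* + a)) (sym (pos-*+ l a x))

  S-top≡ : ∀ x → + x ℤ.+ + k ℤ.* + a ℤ.+ + b ≡ + (k * a + (x + b))
  S-top≡ x = begin
    + x ℤ.+ + k ℤ.* + a ℤ.+ + b    ≡⟨ rearrange (+ x) (+ k ℤ.* + a) (+ b) ⟩
    + k ℤ.* + a ℤ.+ (+ x ℤ.+ + b)  ≡⟨ cong (λ t → + k ℤ.* + a ℤ.+ t) (ℤₚ.pos-+ x b) ⟨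
    + k ℤ.* + a ℤ.+ + (x + b)      ≡⟨ pos-*+ k a (x + b) ⟨
    + (k * a + (x + b))            ∎
    where
      open ≡-Reasoning
      rearrange : ∀ X Y Z → X ℤ.+ Y ℤ.+ Z ≡ Y ℤ.+ (X ℤ.+ Z)
      rearrange = ℤ-Ring.solve-∀

  S-meets-A : ∀ {x} → x < b → inI a b k A (+ x) ≡ false →
              (∃[ l ] l ≤ k × A⁺ (l * a + x)) ⊎ A⁺ (k * a + (x + b))
  S-meets-A {x} x<b x∉I with Any.++⁻ (map (λ l → + x ℤ.+ + l ℤ.* + a) (upTo (suc k)))
                                     (all-not≡false⇒Any A (S a b k (+ x)) (S-test-fails x<b x∉I))
  ... | inj₁ in-column with l , l∈ , Al ← find (Any.map⁻ in-column) =
    inj₁ (l , ≤-pred (∈-upTo⁻ l∈) , subst (_∈A A) (S-column≡ x l) Al)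
  ... | inj₂ (here Atop) = inj₂ (subst (_∈A A) (S-top≡ x) Atop)

  data TPoint (i : ℕ) : ℤ → Set where
    tpoint : ∀ r → b < r → r < a → A⁺ (i * a + r) → i < k → TPoint i (+ (i * a + r))

  InT-lower-bound : ∀ i → + i ℤ.* + a ℤ.+ + b ℤ.+ + 1 ≡ + (i * a + suc b)
  InT-lower-bound i = begin
    + i ℤ.* + a ℤ.+ + b ℤ.+ + 1  ≡⟨ cong (ℤ._+ + 1) (pos-*+ i a b) ⟨
    + (i * a + b) ℤ.+ + 1        ≡⟨ ℤₚ.pos-+ (i * a + b) 1 ⟨
    + (i * a + b + 1)            ≡⟨ cong +_ (solve (i ∷ a ∷ b ∷ [])) ⟩
    + (i * a + suc b)            ∎
    where open ≡-Reasoning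

  toTPoint : ∀ {i α} → i < k → InT a b k A i α → TPoint i α
  toTPoint {i} i<k (α∈A , lower , upper)
    with n , refl , ia+b<n ← nonneg-view (subst (ℤ._≤ _) (InT-lower-bound i) lower)
    with r , refl ← m≤n⇒∃[o]m+o≡n (≤-trans (m≤m+n (i * a) (suc b)) ia+b<n)
    = tpoint r (+-cancelˡ-≤ (i * a) (suc b) r ia+b<n) r<a α∈A i<k
    where
      r<a : r < a
      r<a = +-cancelˡ-< (i * a) r a (subst (i * a + r <_) (+-comm a (i * a))
              (≤[+n-1]⇒< (suc i * a)
                (subst (λ t → + (i * a + r) ℤ.≤ t ℤ.- + 1) (sym (ℤₚ.pos-* (suc i) a)) upper)))

  level-unique : ∀ {i i′ α β} → TPoint i α → TPoint i′ β → α ≡ β → i ≡ i′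
  level-unique (tpoint r _ r<a _ _) (tpoint r′ _ r′<a _ _) α≡β =
    proj₁ (*+-lex-injective (ℤₚ.+-injective α≡β) r<a r′<a)

  lift-to-level-k : ∀ i r → + (i * a + r) ℤ.+ (+ k ℤ.- + i) ℤ.* + a ≡ + (k * a + r)
  lift-to-level-k i r = begin
    + (i * a + r) ℤ.+ (+ k ℤ.- + i) ℤ.* + a
      ≡⟨ cong (λ t → t ℤ.+ (+ k ℤ.- + i) ℤ.* + a) (pos-*+ i a r) ⟩
    + i ℤ.* + a ℤ.+ + r ℤ.+ (+ k ℤ.- + i) ℤ.* + a  ≡⟨ telescope (+ i) (+ a) (+ r) (+ k) ⟩
    + k ℤ.* + a ℤ.+ + r                            ≡⟨ pos-*+ k a r ⟨
    + (k * a + r)                                  ∎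
    where
      open ≡-Reasoning
      telescope : ∀ I A R K → I ℤ.* A ℤ.+ R ℤ.+ (K ℤ.- I) ℤ.* A ≡ K ℤ.* A ℤ.+ R
      telescope = ℤ-Ring.solve-∀

  vOf-tpoint : ∀ i r → vOf a b k i (+ (i * a + r)) ≡ + (k * a + (r + b))
  vOf-tpoint i r = begin
    + (i * a + r) ℤ.+ (+ k ℤ.- + i) ℤ.* + a ℤ.+ + b  ≡⟨ cong (ℤ._+ + b) (lift-to-level-k i r) ⟩
    + (k * a + r) ℤ.+ + b                            ≡⟨ ℤₚ.pos-+ (k * a + r) b ⟨
    + (k * a + r + b)                                ≡⟨ cong +_ (+-assoc (k * a) r b) ⟩
    + (k * a + (r + b))                              ∎
    where open ≡-Reasoning

  remove-level : ∀ i r → + (i * a + r) ℤ.- + i ℤ.* + a ≡ + r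
  remove-level i r =
    trans (cong (λ t → + (i * a + r) ℤ.- t) (sym (ℤₚ.pos-* i a))) (+[m+n]-+m≡+n (i * a) r)

  module _ (avoid : MAvoiding a b k A) where

    avoid-difference : ∀ q e → InM a b k (+ e) → A⁺ (q + e) → A⁺ q → ⊥
    avoid-difference q e e∈M Aq+e Aq =
      avoid _ _ Aq+e Aq (subst (InM a b k) (sym (+[m+n]-+m≡+n q e)) e∈M)

    avoid-l*a : ∀ {L′ L x} → L′ < L → L ≤ L′ + k → A⁺ (L * a + x) → A⁺ (L′ * a + x) → ⊥
    avoid-l*a {L′} {x = x} L′<L L≤L′+k AL AL′ with m≤n⇒∃[o]m+o≡n L′<L
    ... | l , refl = avoid-difference (L′ * a + x) (suc l * a)
                       (inj₁ (suc l , s≤s z≤n , l<k , ℤₚ.pos-* (suc l) a)) (subst A⁺ regroup AL) AL′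
      where
        l<k : suc l ≤ k
        l<k = +-cancelˡ-≤ L′ (suc l) k (subst (_≤ L′ + k) (sym (+-suc L′ l)) L≤L′+k)
        regroup : (suc L′ + l) * a + x ≡ L′ * a + x + suc l * a
        regroup = solve (L′ ∷ l ∷ a ∷ x ∷ [])

    avoid-l*a+b : ∀ {L′ L x} → L′ ≤ L → L ≤ L′ + k → A⁺ (L * a + (x + b)) → A⁺ (L′ * a + x) → ⊥
    avoid-l*a+b {L′} {x = x} L′≤L L≤L′+k AL AL′ with m≤n⇒∃[o]m+o≡n L′≤L
    ... | l , refl = avoid-difference (L′ * a + x) (l * a + b)
                       (inj₂ (l , +-cancelˡ-≤ L′ l k L≤L′+k , pos-*+ l a b)) (subst A⁺ regroup AL) AL′
      where
        regroup : (L′ + l) * a + (x + b) ≡ L′ * a + x + (l * a + b)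
        regroup = solve (L′ ∷ l ∷ a ∷ x ∷ b ∷ [])

    same-residue⇒same-level : ∀ {i i′ r} → i < k → i′ < k →
                              A⁺ (i * a + r) → A⁺ (i′ * a + r) → i ≡ i′
    same-residue⇒same-level {i} {i′} i<k i′<k Ai Ai′ with <-cmp i i′
    ... | tri< i<i′ _ _ = ⊥-elim (avoid-l*a i<i′ (≤-trans (<⇒≤ i′<k) (m≤n+m k i)) Ai′ Ai)
    ... | tri≈ _ i≡i′ _ = i≡i′
    ... | tri> _ _ i′<i = ⊥-elim (avoid-l*a i′<i (≤-trans (<⇒≤ i<k) (m≤n+m k i′)) Ai Ai′)

module Argument (a b d k : ℕ) .{{_ : NonZero b}} (0<d : 0 < d) (b+d≡a : b + d ≡ a)
                (A : ℤ → Bool) (avoid : MAvoiding a b k A) where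

  open Points a b k A

  b≤a : b ≤ a
  b≤a = ≤-trans (m≤m+n b d) (≤-reflexive b+d≡a)

  next-level : ∀ L x → suc L * a + x ≡ L * a + (x + d + b)
  next-level L x = begin
    suc L * a + x          ≡⟨ solve (L ∷ a ∷ x ∷ []) ⟩
    L * a + (x + a)        ≡⟨ cong (λ t → L * a + (x + t)) (sym b+d≡a) ⟩
    L * a + (x + (b + d))  ≡⟨ solve (L ∷ a ∷ x ∷ b ∷ d ∷ []) ⟩
    L * a + (x + d + b)    ∎
    where open ≡-Reasoning

  avoid-l*a-d : ∀ {L′ L x} → L′ < L → L ≤ suc (L′ + k) →
                A⁺ (L * a + x) → A⁺ (L′ * a + (x + d)) → ⊥
  avoid-l*a-d {L = suc L} {x} (s≤s L′≤L) (s≤s L≤L′+k) AL AL′ =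
    avoid-l*a+b avoid L′≤L L≤L′+k (subst A⁺ (next-level L x) AL) AL′

  α̂ : ℕ → ℕ → ℕ
  α̂ y zero    = y
  α̂ y (suc n) = α̂ (y + d) n

  y≤α̂ : ∀ y n → y ≤ α̂ y n
  y≤α̂ y zero    = ≤-refl
  y≤α̂ y (suc n) = ≤-trans (m≤m+n y d) (y≤α̂ (y + d) n)

  α̂≡n*d+y : ∀ y n → α̂ y n ≡ n * d + y
  α̂≡n*d+y y zero    = refl
  α̂≡n*d+y y (suc n) = trans (α̂≡n*d+y (y + d) n) (solve (n ∷ d ∷ y ∷ []))

  α̂-injective : ∀ {y y′} n n′ → y < d → y′ < d → α̂ y n ≡ α̂ y′ n′ → y ≡ y′
  α̂-injective {y} {y′} n n′ y<d y′<d eq =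
    proj₂ (*+-lex-injective {i = n} {n′}
             (trans (sym (α̂≡n*d+y y n)) (trans eq (α̂≡n*d+y y′ n′))) y<d y′<d)

  FailedTests : ℕ → ℕ → Set
  FailedTests y zero    = inI a b k A (+ y) ≡ false
  FailedTests y (suc n) = inI a b k A (+ y) ≡ false × FailedTests (y + d) n

  data SearchResult (y : ℕ) (w : ℤ) : Set where
    found   : ∀ n → α̂ y n < b → w ≡ + α̂ y n → SearchResult y w
    escaped : ∀ n → α̂ y n < b → FailedTests y n → w ≡ + (suc k * a + α̂ y n) → SearchResult y w

  shift : ∀ {y w} → inI a b k A (+ y) ≡ false → SearchResult (y + d) w → SearchResult y w
  shift y∉I (found n lt eq)         = found (suc n) lt eq
  shift y∉I (escaped n lt fails eq) = escaped (suc n) lt (y∉I , fails) eq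

  +a-+b≡+d : + a ℤ.- + b ≡ + d
  +a-+b≡+d = subst (λ t → + t ℤ.- + b ≡ + d) b+d≡a (+[m+n]-+m≡+n b d)

  b≤y+d⇒2b-a≤y : ∀ {y} → b ≤ y + d → + 2 ℤ.* + b ℤ.- + a ℤ.≤ + y
  b≤y+d⇒2b-a≤y {y} b≤y+d = begin
    + 2 ℤ.* + b ℤ.- + a        ≡⟨ regroup (+ a) (+ b) ⟩
    + b ℤ.- (+ a ℤ.- + b)      ≡⟨ cong (λ t → + b ℤ.- t) +a-+b≡+d ⟩
    + b ℤ.- + d                ≤⟨ ℤₚ.+-monoˡ-≤ (ℤ.- + d) (+≤+ b≤y+d) ⟩
    + (y + d) ℤ.- + d          ≡⟨ cong (λ t → + t ℤ.- + d) (+-comm y d) ⟩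
    + (d + y) ℤ.- + d          ≡⟨ +[m+n]-+m≡+n d y ⟩
    + y                        ∎
    where
      open ℤₚ.≤-Reasoning
      regroup : ∀ X Y → + 2 ℤ.* Y ℤ.- X ≡ Y ℤ.- (X ℤ.- Y)
      regroup = ℤ-Ring.solve-∀

  search : ∀ f y → y < b → b ≤ y + f → SearchResult y (wSearch a b k A f (+ y))
  search zero    y y<b b≤y+0 = contradiction (subst (b ≤_) (+-identityʳ y) b≤y+0) (<⇒≱ y<b)
  search (suc f) y y<b b≤y+1+f with inI a b k A (+ y) in y-test
  ... | true = found 0 y<b refl
  ... | false with + 2 ℤ.* + b ℤ.- + a ℤ.≤? + y
  ...   | yes _ =
    escaped 0 y<b y-test (trans (ℤₚ.+-comm (+ y) (+ suc k ℤ.* + a)) (sym (pos-*+ (suc k) a y)))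
  ...   | no y<2b-a = subst (SearchResult y ∘ wSearch a b k A f) (sym step)
                        (shift y-test (search f (y + d) (≰⇒> (y<2b-a ∘ b≤y+d⇒2b-a≤y)) fuel))
    where
      step : + y ℤ.+ (+ a ℤ.- + b) ≡ + (y + d)
      step = trans (cong (λ t → + y ℤ.+ t) +a-+b≡+d) (sym (ℤₚ.pos-+ y d))
      fuel : b ≤ y + d + f
      fuel = ≤-trans b≤y+1+f
               (subst (_≤ y + d + f) (+-assoc y 1 f) (+-monoˡ-≤ f (+-monoʳ-≤ y 0<d)))

  -- large is the paper's case j ≥ 2; small y is j = 1 with α̂_0 = y.
  data WShape (r : ℕ) (w : ℤ) : Set where
    large : w ≡ + (k * a + r) → WShape r w
    small : ∀ y → r ≡ y + b → SearchResult y w → WShape r w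

  shape-by-quotient : ∀ {r y} q → r ≡ y + q * b → y < b → b < r →
    WShape r (if ⌊ + 2 ℤ.≤? + q ⌋ then + (k * a + r) else wSearch a b k A (suc (2 * b)) (+ y))
  shape-by-quotient {y = y} zero r≡y+0 y<b b<r =
    contradiction (subst (_< b) (sym (trans r≡y+0 (+-identityʳ y))) y<b) (<⇒≯ b<r)
  shape-by-quotient {y = y} 1 r≡y+1*b y<b _ =
    small y (trans r≡y+1*b (cong (λ t → y + t) (*-identityˡ b))) (search (suc (2 * b)) y y<b fuel)
    where
      fuel : b ≤ y + suc (2 * b)
      fuel = ≤-trans (m≤m+n b (b + 0)) (≤-trans (n≤1+n (2 * b)) (m≤n+m (suc (2 * b)) y))
  shape-by-quotient (suc (suc q)) _ _ _ = large refl

  w-shape : ∀ i r → b < r → WShape r (wOf a b k A i (+ (i * a + r)))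
  w-shape i r b<r = subst (WShape r) (sym by-quotient)
                      (shape-by-quotient (r / b) (m≡m%n+[m/n]*n r b) (m%n<n r b) b<r)
    where
      by-quotient : wOf a b k A i (+ (i * a + r))
                  ≡ (if ⌊ + 2 ℤ.≤? + (r / b) ⌋ then + (k * a + r)
                     else wSearch a b k A (suc (2 * b)) (+ (r % b)))
      by-quotient = cong₂ (λ x w → if ⌊ + 2 ℤ.≤? x ℤ./ℕ b ⌋ then w
                                   else wSearch a b k A (suc (2 * b)) (+ (x ℤ.%ℕ b)))
                          (remove-level i r) (lift-to-level-k i r)

  y<d : ∀ {r y} → r ≡ y + b → r < a → y < d
  y<d {y = y} refl r<a = +-cancelʳ-< b y d (subst (y + b <_) (trans (sym b+d≡a) (+-comm b d)) r<a)

  found≢escaped : ∀ {x x′} → x < b → + x ≢ + (suc k * a + x′)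
  found≢escaped {x′ = x′} x<b eq =
    <⇒≢ (<-≤-trans x<b (≤-trans b≤a (≤-trans (m≤m+n a (k * a)) (m≤m+n (suc k * a) x′))))
        (ℤₚ.+-injective eq)

  search-injective : ∀ {y y′ w} → y < d → y′ < d → SearchResult y w → SearchResult y′ w → y ≡ y′
  search-injective y<d y′<d (found n _ refl) (found n′ _ eq) =
    α̂-injective n n′ y<d y′<d (ℤₚ.+-injective eq)
  search-injective y<d y′<d (escaped n _ _ refl) (escaped n′ _ _ eq) =
    α̂-injective n n′ y<d y′<d (+-cancelˡ-≡ (suc k * a) _ _ (ℤₚ.+-injective eq))
  search-injective _ _ (found _ lt refl) (escaped _ _ _ eq) = ⊥-elim (found≢escaped lt eq)
  search-injective _ _ (escaped _ _ _ refl) (found _ lt eq) = ⊥-elim (found≢escaped lt (sym eq))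

  search≢large : ∀ {r y w} → b < r → r < a → SearchResult y w → w ≢ + (k * a + r)
  search≢large {r} b<r _ (found _ lt refl) eq =
    <⇒≢ (<-≤-trans (<-trans lt b<r) (m≤n+m r (k * a))) (ℤₚ.+-injective eq)
  search≢large _ r<a (escaped _ _ _ refl) eq =
    <⇒≢ (*+-lex-< (n<1+n k) r<a) (sym (ℤₚ.+-injective eq))

  shape-injective : ∀ {r r′ w} → b < r → r < a → b < r′ → r′ < a →
                    WShape r w → WShape r′ w → r ≡ r′
  shape-injective _ _ _ _ (large refl) (large eq) = +-cancelˡ-≡ (k * a) _ _ (ℤₚ.+-injective eq)
  shape-injective b<r r<a _ _ (large refl) (small _ _ s′) = ⊥-elim (search≢large b<r r<a s′ refl)
  shape-injective _ _ b<r′ r′<a (small _ _ s) (large eq) = ⊥-elim (search≢large b<r′ r′<a s eq)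
  shape-injective _ r<a _ r′<a (small y r≡y+b s) (small y′ r′≡y′+b s′) = begin
    _      ≡⟨ r≡y+b ⟩
    y + b  ≡⟨ cong (_+ b) (search-injective (y<d r≡y+b r<a) (y<d r′≡y′+b r′<a) s s′) ⟩
    y′ + b ≡⟨ r′≡y′+b ⟨
    _      ∎
    where open ≡-Reasoning

  w≡v⇒shifted-or-escaped : ∀ {s t w} → WShape s w → w ≡ + (k * a + (t + b)) →
    s ≡ t + b ⊎ ∃₂ λ y n → s ≡ y + b × α̂ y n < b × FailedTests y n × t ≡ α̂ y n + d
  w≡v⇒shifted-or-escaped (large refl) eq = inj₁ (+-cancelˡ-≡ (k * a) _ _ (ℤₚ.+-injective eq))
  w≡v⇒shifted-or-escaped {t = t} (small _ _ (found _ lt refl)) eq =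
    ⊥-elim (<⇒≢ (<-≤-trans lt (≤-trans (m≤n+m b t) (m≤n+m (t + b) (k * a)))) (ℤₚ.+-injective eq))
  w≡v⇒shifted-or-escaped {t = t} (small y s≡y+b (escaped n lt fails refl)) eq =
    inj₂ (y , n , s≡y+b , lt , fails , sym α̂+d≡t)
    where
      α̂+d≡t : α̂ y n + d ≡ t
      α̂+d≡t = +-cancelʳ-≡ b _ _ (+-cancelˡ-≡ (k * a) _ _
                 (trans (sym (next-level k (α̂ y n))) (ℤₚ.+-injective eq)))

  WitnessAbove : ℕ → ℕ → Set
  WitnessAbove i x = ∃[ L ] i < L × L ≤ k × A⁺ (L * a + x)

  climb-start : ∀ {i y} → i < k → A⁺ (i * a + (y + b)) → y < b → inI a b k A (+ y) ≡ false →
                WitnessAbove i y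
  climb-start {i} i<k Aα y<b y∉I with S-meets-A y<b y∉I
  ... | inj₂ Atop = ⊥-elim (avoid-l*a avoid i<k (m≤n+m k i) Atop Aα)
  ... | inj₁ (l , l≤k , Al) with i <? l
  ...   | yes i<l = l , i<l , l≤k , Al
  ...   | no i≮l  = ⊥-elim (avoid-l*a+b avoid (≮⇒≥ i≮l) (≤-trans (<⇒≤ i<k) (m≤n+m k l)) Aα Al)

  climb-step : ∀ {i x} → WitnessAbove i x → x + d < b → inI a b k A (+ (x + d)) ≡ false →
               WitnessAbove i (x + d)
  climb-step {x = x} (L , i<L , L≤k , AL) x+d<b x+d∉I with S-meets-A x+d<b x+d∉I
  ... | inj₂ Atop = ⊥-elim (avoid-l*a avoid (s≤s L≤k) (+-monoˡ-≤ k (≤-trans (s≤s z≤n) i<L))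
                              (subst A⁺ (sym (next-level k x)) Atop) AL)
  ... | inj₁ (l , l≤k , Al) with L ≤? l
  ...   | yes L≤l = l , <-≤-trans i<L L≤l , l≤k , Al
  ...   | no L≰l  =
    ⊥-elim (avoid-l*a-d (≰⇒> L≰l) (≤-trans L≤k (≤-trans (m≤n+m k l) (n≤1+n _))) AL Al)

  climb-from : ∀ {i x} n → WitnessAbove i x → α̂ (x + d) n < b → FailedTests (x + d) n →
               WitnessAbove i (α̂ (x + d) n)
  climb-from zero    above lt x+d∉I = climb-step above lt x+d∉I
  climb-from {x = x} (suc n) above lt (x+d∉I , fails) =
    climb-from n (climb-step above (≤-<-trans (y≤α̂ (x + d) (suc n)) lt) x+d∉I) lt fails

  climb : ∀ {i y} n → i < k → A⁺ (i * a + (y + b)) → α̂ y n < b → FailedTests y n →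
          WitnessAbove i (α̂ y n)
  climb zero    i<k Aα lt y∉I = climb-start i<k Aα lt y∉I
  climb {y = y} (suc n) i<k Aα lt (y∉I , fails) =
    climb-from n (climb-start i<k Aα (≤-<-trans (y≤α̂ y (suc n)) lt) y∉I) lt fails

  escape-blocks : ∀ {i j y} n → i < k → A⁺ (i * a + (y + b)) → α̂ y n < b → FailedTests y n →
                  j ≤ i → A⁺ (j * a + (α̂ y n + d)) → ⊥
  escape-blocks {j = j} n i<k Aα lt fails j≤i Aj =
    let L , i<L , L≤k , AL = climb n i<k Aα lt fails
    in avoid-l*a-d (≤-<-trans j≤i i<L) (≤-trans L≤k (≤-trans (m≤n+m k j) (n≤1+n _))) AL Aj

  w≢v-below : ∀ {i i′ α β} → TPoint i α → TPoint i′ β → β ℤ.< α →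
              wOf a b k A i α ≢ vOf a b k i′ β
  w≢v-below {i} {i′} (tpoint r b<r r<a Aα i<k) (tpoint r′ _ _ Aβ _) β<α eq with i′ ≤? i
  ... | no i′≰i = <-asym (ℤₚ.drop‿+<+ β<α) (*+-lex-< (≰⇒> i′≰i) r<a)
  ... | yes i′≤i with w≡v⇒shifted-or-escaped (w-shape i r b<r) (trans eq (vOf-tpoint i′ r′))
  ...   | inj₁ r≡r′+b = avoid-l*a+b avoid i′≤i (≤-trans (<⇒≤ i<k) (m≤n+m k i′))
                          (subst (λ t → A⁺ (i * a + t)) r≡r′+b Aα) Aβ
  ...   | inj₂ (y , n , r≡y+b , lt , fails , r′≡α̂+d) =
    escape-blocks n i<k (subst (λ t → A⁺ (i * a + t)) r≡y+b Aα) lt fails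
                  i′≤i (subst (λ t → A⁺ (i′ * a + t)) r′≡α̂+d Aβ)

  v≢w-below : ∀ {i α β} → TPoint i α → TPoint i β → β ℤ.< α →
              vOf a b k i α ≢ wOf a b k A i β
  v≢w-below {i} (tpoint r _ _ Aα i<k) (tpoint r′ b<r′ _ Aβ _) β<α eq
    with w≡v⇒shifted-or-escaped (w-shape i r′ b<r′) (trans (sym eq) (vOf-tpoint i r))
  ... | inj₁ r′≡r+b =
    <⇒≱ (+-cancelˡ-< (i * a) r′ r (ℤₚ.drop‿+<+ β<α)) (subst (r ≤_) (sym r′≡r+b) (m≤m+n r b))
  ... | inj₂ (y , n , r′≡y+b , lt , fails , r≡α̂+d) =
    escape-blocks n i<k (subst (λ t → A⁺ (i * a + t)) r′≡y+b Aβ) lt fails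
                  ≤-refl (subst (λ t → A⁺ (i * a + t)) r≡α̂+d Aα)

  v-injective : ∀ {i i′ α β} → TPoint i α → TPoint i′ β →
                vOf a b k i α ≡ vOf a b k i′ β → α ≡ β
  v-injective {i} {i′} (tpoint r _ _ Aα i<k) (tpoint r′ _ _ Aβ i′<k) eq
    with refl ← +-cancelʳ-≡ b r r′ (+-cancelˡ-≡ (k * a) _ _
                  (ℤₚ.+-injective (trans (sym (vOf-tpoint i r)) (trans eq (vOf-tpoint i′ r′)))))
    with refl ← same-residue⇒same-level avoid i<k i′<k Aα Aβ
    = refl

  w-injective : ∀ {i i′ α β} → TPoint i α → TPoint i′ β →
                wOf a b k A i α ≡ wOf a b k A i′ β → α ≡ β
  w-injective {i} {i′} (tpoint r b<r r<a Aα i<k) (tpoint r′ b<r′ r′<a Aβ i′<k) eq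
    with refl ← shape-injective b<r r<a b<r′ r′<a
                  (w-shape i r b<r) (subst (WShape r′) (sym eq) (w-shape i′ r′ b<r′))
    with refl ← same-residue⇒same-level avoid i<k i′<k Aα Aβ
    = refl

  module _ {i i′ α β} (p : TPoint i α) (q : TPoint i′ β) (β<α : β ℤ.< α) where

    meet-below : ∀ {z} → InCap a b k A i α i′ β z → z ≡ vOf a b k i α × z ≡ wOf a b k A i′ β
    meet-below (inj₁ z≡vα , inj₂ z≡wβ) = z≡vα , z≡wβ
    meet-below (inj₁ z≡vα , inj₁ z≡vβ) =
      ⊥-elim (ℤₚ.<⇒≢ β<α (sym (v-injective p q (trans (sym z≡vα) z≡vβ))))
    meet-below (inj₂ z≡wα , inj₂ z≡wβ) =
      ⊥-elim (ℤₚ.<⇒≢ β<α (sym (w-injective p q (trans (sym z≡wα) z≡wβ))))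
    meet-below (inj₂ z≡wα , inj₁ z≡vβ) = ⊥-elim (w≢v-below p q β<α (trans (sym z≡wα) z≡vβ))

    meets-exactly-once : Meets a b k A i α i′ β → MeetsExactlyOnce a b k A i α i′ β
    meets-exactly-once (z , cap) =
      z , cap , λ z′ cap′ → trans (proj₁ (meet-below cap′)) (sym (proj₁ (meet-below cap)))

    meets-across-levels : Meets a b k A i α i′ β → i ≢ i′
    meets-across-levels (_ , cap) refl =
      let z≡vα , z≡wβ = meet-below cap in v≢w-below p q β<α (trans (sym z≡vα) z≡wβ)

  lower-partner-unique : ∀ {i i₁ i₂ α β β′} → TPoint i α → TPoint i₁ β → TPoint i₂ β′ →
                         β ℤ.< α → β′ ℤ.< α →
                         Meets a b k A i α i₁ β → Meets a b k A i α i₂ β′ → β ≡ β′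
  lower-partner-unique p q q′ β<α β′<α (_ , cap) (_ , cap′) =
    let z≡vα , z≡wβ = meet-below p q β<α cap ; z′≡vα , z′≡wβ′ = meet-below p q′ β′<α cap′
    in w-injective q q′ (trans (sym z≡wβ) (trans z≡vα (trans (sym z′≡vα) z′≡wβ′)))

  upper-partner-unique : ∀ {i₁ i₂ i′ α α′ β} → TPoint i₁ α → TPoint i₂ α′ → TPoint i′ β →
                         β ℤ.< α → β ℤ.< α′ →
                         Meets a b k A i₁ α i′ β → Meets a b k A i₂ α′ i′ β → α ≡ α′
  upper-partner-unique p p′ q β<α β<α′ (_ , cap) (_ , cap′) =
    let z≡vα , z≡wβ = meet-below p q β<α cap ; z′≡vα′ , z′≡wβ = meet-below p′ q β<α′ cap′
    in v-injective p p′ (trans (sym z≡vα) (trans z≡wβ (trans (sym z′≡wβ) z′≡vα′)))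

mainTheorem2 :
    (a b k : ℕ) .{{_ : NonZero b}} → b ℕ.< a → 1 ℕ.≤ k →
    (A : ℤ → Bool) → MAvoiding a b k A → (+ 0) ∈A A →
    -- (1)
    ((i : ℕ) → i ℕ.< k → (α : ℤ) → InT a b k A i α →
      ((i₁ : ℕ) (β : ℤ) (i₂ : ℕ) (β′ : ℤ) →
        i₁ ℕ.< k → InT a b k A i₁ β → i₂ ℕ.< k → InT a b k A i₂ β′ →
        β ℤ.< α → β′ ℤ.< α →
        Meets a b k A i α i₁ β → Meets a b k A i α i₂ β′ → β ≡ β′)
      × ((i₁ : ℕ) (β : ℤ) → i₁ ℕ.< k → InT a b k A i₁ β → β ℤ.< α →
        Meets a b k A i α i₁ β →
        MeetsExactlyOnce a b k A i α i₁ β × ¬ InT a b k A i β))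
    ×
    -- (2)
    ((i′ : ℕ) → i′ ℕ.< k → (β : ℤ) → InT a b k A i′ β →
      ((i₁ : ℕ) (α : ℤ) (i₂ : ℕ) (α′ : ℤ) →
        i₁ ℕ.< k → InT a b k A i₁ α → i₂ ℕ.< k → InT a b k A i₂ α′ →
        β ℤ.< α → β ℤ.< α′ →
        Meets a b k A i₁ α i′ β → Meets a b k A i₂ α′ i′ β → α ≡ α′)
      × ((i₁ : ℕ) (α : ℤ) → i₁ ℕ.< k → InT a b k A i₁ α → β ℤ.< α →
        Meets a b k A i₁ α i′ β →
        MeetsExactlyOnce a b k A i₁ α i′ β × ¬ InT a b k A i′ α))
mainTheorem2 a b k b<a _ A avoid _ =
    (λ i i<k α α∈Tᵢ →
        (λ i₁ β i₂ β′ i₁<k β∈T i₂<k β′∈T →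
          lower-partner-unique (toTPoint i<k α∈Tᵢ) (toTPoint i₁<k β∈T) (toTPoint i₂<k β′∈T))
      , λ i₁ β i₁<k β∈T β<α meet →
          let p = toTPoint i<k α∈Tᵢ ; q = toTPoint i₁<k β∈T
          in meets-exactly-once p q β<α meet
           , λ β∈Tᵢ → meets-across-levels p q β<α meet (level-unique (toTPoint i<k β∈Tᵢ) q refl))
  , (λ i′ i′<k β β∈Tᵢ′ →
        (λ i₁ α i₂ α′ i₁<k α∈T i₂<k α′∈T →
          upper-partner-unique (toTPoint i₁<k α∈T) (toTPoint i₂<k α′∈T) (toTPoint i′<k β∈Tᵢ′))
      , λ i₁ α i₁<k α∈T β<α meet →
          let p = toTPoint i₁<k α∈T ; q = toTPoint i′<k β∈Tᵢ′
          in meets-exactly-once p q β<α meet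
           , λ α∈Tᵢ′ → meets-across-levels p q β<α meet (level-unique p (toTPoint i′<k α∈Tᵢ′) refl))
  where
    open Points a b k A using (toTPoint; level-unique)
    open Argument a b (a ∸ b) k (m<n⇒0<n∸m b<a) (m+[n∸m]≡n (<⇒≤ b<a)) A avoid
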